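{- Let $q,d$ be positive integers with $\gcd(2q,d)=1$. For $i\in\{ -1,0,1\}$ define the multisets $A_i=\{m(q+d)+i: m\in\mathbb{N}\}$, $B_i=\{m(q+d)-nd+i: m\in\mathbb{N}\setminus\{0,1\},\ n\in\{1,\dots,\lfloor m/2\rfloor\}\}$, and $C_i=A_i\cup B_i$. Then for every $i\in\{ -1,0,1\}$ and every $x\in\mathbb{Z}$, $$\mathfrak{m}_{B_i}(x)=\mathfrak{m}_{C_i}(x-(2q+d)).$$
   Context: For a multiset $M$ of integers, $\mathfrak{m}_M:\mathbb{Z}\to\mathbb{N}$ gives the number of times an integer appears in $M$ ($0$ if it does not appear). In $B_i$ multiplicities are counted over all index pairs $(m,n)$; $C_i$ is the multiset union with multiplicities added, i.e. $\mathfrak{m}_{C_i}=\mathfrak{m}_{A_i}+\mathfrak{m}_{B_i}$ (equivalently $C_i=\{m(q+d)-nd+i: m\in\mathbb{N},\ 0\le n\le\lfloor m/2\rfloor\}$). $\mathbb{N}$ includes $0$. -}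

module Defs where

open import Data.Nat using (ℕ; zero; suc; _/_)
open import Data.Nat as ℕ using ()
open import Data.Integer using (ℤ; +_; _+_; _-_; _*_; ∣_∣)
open import Data.Integer.Properties using (_≟_)
open import Data.List using (List; upTo; map; concatMap; filter; length)
open import Data.Product using (_×_; _,_)

pairs : ℕ → (ℕ → List ℕ) → List (ℕ × ℕ)
pairs N ns = concatMap (λ m → map (m ,_) (ns m)) (upTo (suc N))

elt : ℕ → ℕ → ℤ → ℕ × ℕ → ℤ
elt q d i (m , n) = (+ m) * (+ q + + d) - (+ n) * (+ d) + i

countIn : ℕ → ℕ → ℤ → ℤ → List (ℕ × ℕ) → ℕ
countIn q d i x ps = length (filter (λ p → elt q d i p ≟ x) ps)

-- For q , d ≥ 1 and 0 ≤ n ≤ ⌊m/2⌋ one has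
-- m(q+d) - n d ≥ m q ≥ m, so an index (m , n) producing x satisfies
-- m ≤ x - i ≤ ∣ x ∣ + 1 (as ∣ i ∣ ≤ 1); every index pair producing x
-- is therefore counted.
bound : ℤ → ℕ
bound x = suc ∣ x ∣

multA : ℕ → ℕ → ℤ → ℤ → ℕ
multA q d i x = countIn q d i x (pairs (bound x) (λ _ → 0 Data.List.∷ Data.List.[]))

-- 𝔪_{B_i}(x): B_i = { m(q+d) - n d + i : m ≥ 2, 1 ≤ n ≤ ⌊m/2⌋ }
-- (for m ∈ {0,1} the range of n is empty, so m ranges over all of ℕ)
multB : ℕ → ℕ → ℤ → ℤ → ℕ
multB q d i x = countIn q d i x (pairs (bound x) (λ m → map suc (upTo (m / 2))))

multC : ℕ → ℕ → ℤ → ℤ → ℕ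
multC q d i x = multA q d i x ℕ.+ multB q d i x

{-# OPTIONS --safe #-}
-- The map (m , n) ↦ (m + 2 , n + 1) sends the
-- index pairs of C_i (row m, 0 ≤ n ≤ ⌊m/2⌋) bijectively onto those of B_i in row m + 2, and it adds
-- exactly 2q + d to m(q+d) - nd + i; rows 0 and 1 of B_i are empty. Counting row by row therefore
-- gives the identity, once one knows that only finitely many rows can hit a given value: for
-- n ≤ m the element equals mq + (m - n)d + i ≥ m - 1.
module Submission where

open import Defs
open import Data.Nat using (ℕ; _≤_; _*_)
open import Data.Nat.GCD using (gcd)
open import Data.Integer using (ℤ; +_; -_; _-_; _+_)
open import Data.Sum using (_⊎_)
open import Relation.Binary.PropositionalEquality using (_≡_)

open import Data.Nat as ℕ using (zero; suc; NonZero; _/_; z≤n; s≤s; z<s; s<s)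
import Data.Nat.Properties as ℕP
open import Data.Nat.DivMod using (m/n≤m; m/n≡1+[m∸n]/n)
open import Data.Integer as ℤ using (-[1+_]; ∣_∣; -1ℤ; +≤+; +<+; -≤+)
import Data.Integer.Properties as ℤP
open import Data.Integer.Properties using (_≟_)
open import Data.Integer.Tactic.RingSolver using (solve-∀)
open import Algebra.Properties.CommutativeSemigroup ℕP.+-commutativeSemigroup using (interchange)
open import Algebra.Properties.AbelianGroup ℤP.+-0-abelianGroup using (//-rightDividesˡ; //-rightDividesʳ)
open import Data.List using (List; []; _∷_; _++_; map; applyUpTo; upTo; filter; length; concatMap)
open import Data.List.Properties using (filter-++; length-++)
open import Data.Product using (_×_; _,_)
open import Data.Sum using (inj₁; inj₂)
open import Data.Empty using (⊥-elim)
open import Function using (_∘_; id)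
open import Relation.Nullary using (Dec; yes; no; ¬_)
open import Relation.Unary using (Pred; Decidable)
open import Relation.Binary.PropositionalEquality using (_≢_; refl; sym; trans; cong; cong₂; module ≡-Reasoning)

sumTo : (ℕ → ℕ) → ℕ → ℕ
sumTo g zero    = 0
sumTo g (suc n) = g 0 ℕ.+ sumTo (g ∘ suc) n

sumTo-cong : ∀ {g h : ℕ → ℕ} n → (∀ j → g j ≡ h j) → sumTo g n ≡ sumTo h n
sumTo-cong zero    g≗h = refl
sumTo-cong (suc n) g≗h = cong₂ ℕ._+_ (g≗h 0) (sumTo-cong n (g≗h ∘ suc))

sumTo-+ : ∀ (g h : ℕ → ℕ) n → sumTo (λ j → g j ℕ.+ h j) n ≡ sumTo g n ℕ.+ sumTo h n
sumTo-+ g h zero    = refl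
sumTo-+ g h (suc n) = trans (cong (g 0 ℕ.+ h 0 ℕ.+_) (sumTo-+ (g ∘ suc) (h ∘ suc) n))
                            (interchange (g 0) (h 0) _ _)

sumTo-zero : ∀ (g : ℕ → ℕ) n → (∀ j → j ℕ.< n → g j ≡ 0) → sumTo g n ≡ 0
sumTo-zero g zero    vanish = refl
sumTo-zero g (suc n) vanish =
  cong₂ ℕ._+_ (vanish 0 z<s) (sumTo-zero (g ∘ suc) n (λ j j<n → vanish (suc j) (s<s j<n)))

sumTo-truncate : ∀ (g : ℕ → ℕ) {N M} → N ≤ M → (∀ m → N ≤ m → g m ≡ 0) → sumTo g M ≡ sumTo g N
sumTo-truncate g {M = M} z≤n     vanish = sumTo-zero g M (λ m _ → vanish m z≤n)
sumTo-truncate g         (s≤s N≤M) vanish =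
  cong (g 0 ℕ.+_) (sumTo-truncate (g ∘ suc) N≤M (λ m N≤m → vanish (suc m) (s≤s N≤m)))

sumTo-support : ∀ (g : ℕ → ℕ) N M → (∀ m → N ≤ m → g m ≡ 0) → (∀ m → M ≤ m → g m ≡ 0) →
                sumTo g N ≡ sumTo g M
sumTo-support g N M vanishN vanishM with ℕP.≤-total N M
... | inj₁ N≤M = sym (sumTo-truncate g N≤M vanishN)
... | inj₂ M≤N = sumTo-truncate g M≤N vanishM

indicator : ∀ {a} {A : Set a} → Dec A → ℕ
indicator (yes _) = 1
indicator (no _)  = 0

indicator-⇔ : ∀ {a b} {A : Set a} {B : Set b} (A? : Dec A) (B? : Dec B) → (A → B) → (B → A) →
              indicator A? ≡ indicator B?
indicator-⇔ (yes _) (yes _)  _ _ = refl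
indicator-⇔ (no _)  (no _)   _ _ = refl
indicator-⇔ (yes a) (no ¬b)  f _ = ⊥-elim (¬b (f a))
indicator-⇔ (no ¬a) (yes b)  _ g = ⊥-elim (¬a (g b))

indicator-¬ : ∀ {a} {A : Set a} (A? : Dec A) → ¬ A → indicator A? ≡ 0
indicator-¬ (yes a) ¬a = ⊥-elim (¬a a)
indicator-¬ (no _)  _  = refl

map-applyUpTo : ∀ {a b} {A : Set a} {B : Set b} (g : A → B) (f : ℕ → A) n →
                map g (applyUpTo f n) ≡ applyUpTo (g ∘ f) n
map-applyUpTo g f zero    = refl
map-applyUpTo g f (suc n) = cong (g (f 0) ∷_) (map-applyUpTo g (f ∘ suc) n)

module _ {a p} {A : Set a} {P : Pred A p} (P? : Decidable P) where

  count-applyUpTo : ∀ (f : ℕ → A) n →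
                    length (filter P? (applyUpTo f n)) ≡ sumTo (λ j → indicator (P? (f j))) n
  count-applyUpTo f zero = refl
  count-applyUpTo f (suc n) with P? (f 0)
  ... | yes _ = cong suc (count-applyUpTo (f ∘ suc) n)
  ... | no _  = count-applyUpTo (f ∘ suc) n

  count-concatMap-applyUpTo : ∀ {b} {B : Set b} (L : B → List A) (f : ℕ → B) n →
    length (filter P? (concatMap L (applyUpTo f n))) ≡ sumTo (λ j → length (filter P? (L (f j)))) n
  count-concatMap-applyUpTo L f zero    = refl
  count-concatMap-applyUpTo L f (suc n) = begin
    length (filter P? (L (f 0) ++ rest))
      ≡⟨ cong length (filter-++ P? (L (f 0)) rest) ⟩
    length (filter P? (L (f 0)) ++ filter P? rest)
      ≡⟨ length-++ (filter P? (L (f 0))) ⟩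
    length (filter P? (L (f 0))) ℕ.+ length (filter P? rest)
      ≡⟨ cong (length (filter P? (L (f 0))) ℕ.+_) (count-concatMap-applyUpTo L (f ∘ suc) n) ⟩
    sumTo (λ j → length (filter P? (L (f j)))) (suc n) ∎
    where
    open ≡-Reasoning
    rest : List A
    rest = concatMap L (applyUpTo (f ∘ suc) n)

i≤+∣i∣ : ∀ i → i ℤ.≤ + ∣ i ∣
i≤+∣i∣ (+ n)    = ℤP.≤-refl
i≤+∣i∣ -[1+ n ] = -≤+

suc[i-c]<i : ∀ x {c} → 2 ≤ c → ℤ.suc (x - + c) ℤ.< x
suc[i-c]<i x {suc (suc k)} (s≤s (s≤s _)) = begin-strict
  ℤ.suc (x - + suc (suc k))  ≡⟨ regroup x (+ k) ⟩
  ℤ.pred x - + k             ≤⟨ ℤP.i-j≤i (ℤ.pred x) (+ k) ⟩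
  ℤ.pred x                   <⟨ ℤP.i≤pred[j]⇒i<j ℤP.≤-refl ⟩
  x                          ∎
  where
  open ℤP.≤-Reasoning
  regroup : ∀ X K → ℤ.1ℤ + (X - (+ 2 + K)) ≡ (-1ℤ + X) - K
  regroup = solve-∀

module Multiplicities (q d : ℕ) (i : ℤ) where

  elt-shift : ∀ m n → elt q d i (2 ℕ.+ m , 1 ℕ.+ n) ≡ elt q d i (m , n) + (+ (2 * q) + + d)
  elt-shift m n = begin
    (+ 2 + + m) ℤ.* (+ q + + d) - (+ 1 + + n) ℤ.* + d + i
      ≡⟨ regroup (+ m) (+ n) (+ q) (+ d) i ⟩
    elt q d i (m , n) + (+ 2 ℤ.* + q + + d)
      ≡⟨ cong (λ c → elt q d i (m , n) + (c + + d)) (sym (ℤP.pos-* 2 q)) ⟩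
    elt q d i (m , n) + (+ (2 * q) + + d) ∎
    where
    open ≡-Reasoning
    regroup : ∀ M N Q D I → (+ 2 + M) ℤ.* (Q + D) - (+ 1 + N) ℤ.* D + I
                          ≡ (M ℤ.* (Q + D) - N ℤ.* D + I) + (+ 2 ℤ.* Q + D)
    regroup = solve-∀

  elt-split : ∀ n r → elt q d i (n ℕ.+ r , n) ≡ + ((n ℕ.+ r) * q ℕ.+ r * d) + i
  elt-split n r = begin
    (+ n + + r) ℤ.* (+ q + + d) - + n ℤ.* + d + i
      ≡⟨ regroup (+ n) (+ r) (+ q) (+ d) i ⟩
    (+ n + + r) ℤ.* + q + + r ℤ.* + d + i
      ≡⟨ cong₂ (λ a b → a + b + i) (sym (ℤP.pos-* (n ℕ.+ r) q)) (sym (ℤP.pos-* r d)) ⟩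
    + ((n ℕ.+ r) * q ℕ.+ r * d) + i ∎
    where
    open ≡-Reasoning
    regroup : ∀ N R Q D I → (N + R) ℤ.* (Q + D) - N ℤ.* D + I ≡ (N + R) ℤ.* Q + R ℤ.* D + I
    regroup = solve-∀

  elt-lowerBound : ∀ {m n} .{{_ : NonZero q}} → n ≤ m → + m + i ℤ.≤ elt q d i (m , n)
  elt-lowerBound {m} {n} n≤m with m ℕ.∸ n | ℕP.m+[n∸m]≡n n≤m
  ... | r | refl = begin
    + (n ℕ.+ r) + i                         ≤⟨ ℤP.+-monoˡ-≤ i (+≤+ m≤mq+rd) ⟩
    + ((n ℕ.+ r) * q ℕ.+ r * d) + i         ≡⟨ sym (elt-split n r) ⟩
    elt q d i (n ℕ.+ r , n)                 ∎
    where
    open ℤP.≤-Reasoning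
    m≤mq+rd : n ℕ.+ r ≤ (n ℕ.+ r) * q ℕ.+ r * d
    m≤mq+rd = ℕP.≤-trans (ℕP.m≤m*n (n ℕ.+ r) q) (ℕP.m≤m+n _ (r * d))

  elt-≢ : ∀ {m n z} .{{_ : NonZero q}} → -1ℤ ℤ.≤ i → n ≤ m → ℤ.suc z ℤ.< + m → elt q d i (m , n) ≢ z
  elt-≢ {m} {n} -1≤i n≤m z+1<m refl = ℤP.<⇒≱ z+1<m (begin
    + m                           ≡⟨ sym (ℤP.suc-pred (+ m)) ⟩
    ℤ.suc (ℤ.pred (+ m))          ≤⟨ ℤP.suc-mono pred[m]≤elt ⟩
    ℤ.suc (elt q d i (m , n))     ∎)
    where
    open ℤP.≤-Reasoning
    pred[m]≤elt : ℤ.pred (+ m) ℤ.≤ elt q d i (m , n)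
    pred[m]≤elt = begin
      -1ℤ + + m                   ≤⟨ ℤP.+-monoˡ-≤ (+ m) -1≤i ⟩
      i + + m                     ≡⟨ ℤP.+-comm i (+ m) ⟩
      + m + i                     ≤⟨ elt-lowerBound n≤m ⟩
      elt q d i (m , n)           ∎

  elt≟ : ∀ x → Decidable (λ p → elt q d i p ≡ x)
  elt≟ x p = elt q d i p ≟ x

  rowMultA rowMultB rowMultC : ℤ → ℕ → ℕ
  rowMultA x m = indicator (elt≟ x (m , 0))
  rowMultB x m = sumTo (λ n → indicator (elt≟ x (m , suc n))) (m / 2)
  rowMultC x m = rowMultA x m ℕ.+ rowMultB x m

  multA≡sumTo-rowMultA : ∀ x → multA q d i x ≡ sumTo (rowMultA x) (suc (bound x))
  multA≡sumTo-rowMultA x =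
    trans (count-concatMap-applyUpTo (elt≟ x) (λ m → map (m ,_) (0 ∷ [])) id (suc (bound x)))
          (sumTo-cong (suc (bound x)) λ m →
            trans (count-applyUpTo (elt≟ x) (λ _ → m , 0) 1) (ℕP.+-identityʳ (rowMultA x m)))

  multB≡sumTo-rowMultB : ∀ x → multB q d i x ≡ sumTo (rowMultB x) (suc (bound x))
  multB≡sumTo-rowMultB x =
    trans (count-concatMap-applyUpTo (elt≟ x) row id (suc (bound x)))
          (sumTo-cong (suc (bound x)) λ m →
            trans (cong (length ∘ filter (elt≟ x)) (row≡applyUpTo m))
                  (count-applyUpTo (elt≟ x) (λ n → m , suc n) (m / 2)))
    where
    row : ℕ → List (ℕ × ℕ)
    row m = map (m ,_) (map suc (upTo (m / 2)))
    row≡applyUpTo : ∀ m → row m ≡ applyUpTo (λ n → m , suc n) (m / 2)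
    row≡applyUpTo m = trans (cong (map (m ,_)) (map-applyUpTo suc id (m / 2))) (map-applyUpTo (m ,_) suc (m / 2))

  multC≡sumTo-rowMultC : ∀ x → multC q d i x ≡ sumTo (rowMultC x) (suc (bound x))
  multC≡sumTo-rowMultC x = trans (cong₂ ℕ._+_ (multA≡sumTo-rowMultA x) (multB≡sumTo-rowMultB x))
                                 (sym (sumTo-+ (rowMultA x) (rowMultB x) (suc (bound x))))

  rowMultB-shift : ∀ x m → rowMultB x (2 ℕ.+ m) ≡ rowMultC (x - (+ (2 * q) + + d)) m
  rowMultB-shift x m = begin
    sumTo term ((2 ℕ.+ m) / 2)    ≡⟨ cong (sumTo term) (m/n≡1+[m∸n]/n {2 ℕ.+ m} (s≤s (s≤s z≤n))) ⟩
    sumTo term (suc (m / 2))      ≡⟨ sumTo-cong (suc (m / 2)) (λ n →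
                                       indicator-⇔ (elt≟ x (2 ℕ.+ m , suc n)) (elt≟ y (m , n)) (unshift n) (shift n)) ⟩
    rowMultC y m                  ∎
    where
    open ≡-Reasoning
    c y : ℤ
    c = + (2 * q) + + d
    y = x - c
    term : ℕ → ℕ
    term n = indicator (elt≟ x (2 ℕ.+ m , suc n))
    unshift : ∀ n → elt q d i (2 ℕ.+ m , suc n) ≡ x → elt q d i (m , n) ≡ y
    unshift n eq = trans (sym (//-rightDividesʳ c (elt q d i (m , n)))) (cong (_- c) (trans (sym (elt-shift m n)) eq))
    shift : ∀ n → elt q d i (m , n) ≡ y → elt q d i (2 ℕ.+ m , suc n) ≡ x
    shift n eq = trans (elt-shift m n) (trans (cong (_+ c) eq) (//-rightDividesˡ c x))

  rowMultC-vanishes : ∀ {z m} .{{_ : NonZero q}} → -1ℤ ℤ.≤ i → ℤ.suc z ℤ.< + m → rowMultC z m ≡ 0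
  rowMultC-vanishes {m = m} -1≤i z+1<m = cong₂ ℕ._+_
    (indicator-¬ _ (elt-≢ -1≤i z≤n z+1<m))
    (sumTo-zero _ (m / 2) λ n n<m/2 →
      indicator-¬ _ (elt-≢ -1≤i (ℕP.≤-trans n<m/2 (m/n≤m m 2)) z+1<m))

-1≤i : ∀ {i} → i ≡ - (+ 1) ⊎ i ≡ + 0 ⊎ i ≡ + 1 → -1ℤ ℤ.≤ i
-1≤i (inj₁ refl)        = ℤP.≤-refl
-1≤i (inj₂ (inj₁ refl)) = -≤+
-1≤i (inj₂ (inj₂ refl)) = -≤+

lemma6p4 : (q d : ℕ) → 1 ≤ q → 1 ≤ d → gcd (2 * q) d ≡ 1 →
    (i : ℤ) → (i ≡ - (+ 1) ⊎ i ≡ + 0 ⊎ i ≡ + 1) →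
    (x : ℤ) → multB q d i x ≡ multC q d i (x - (+ (2 * q) + + d))
lemma6p4 q@(suc _) d _ _ _ i i∈ x = begin
  multB q d i x                      ≡⟨ multB≡sumTo-rowMultB x ⟩
  -- the summands for rows 0 and 1 reduce to 0
  sumTo (rowMultB x) (2 ℕ.+ ∣ x ∣)   ≡⟨ sumTo-cong ∣ x ∣ (rowMultB-shift x) ⟩
  sumTo (rowMultC y) ∣ x ∣           ≡⟨ sumTo-support (rowMultC y) _ _ (vanish beyond-x) (vanish beyond-y) ⟩
  sumTo (rowMultC y) (suc (bound y)) ≡⟨ sym (multC≡sumTo-rowMultC y) ⟩
  multC q d i y                      ∎
  where
  open ≡-Reasoning
  open Multiplicities q d i
  y : ℤ
  y = x - (+ (2 * q) + + d)
  vanish : ∀ {N} → (∀ {m} → N ≤ m → ℤ.suc y ℤ.< + m) → ∀ m → N ≤ m → rowMultC y m ≡ 0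
  vanish below m N≤m = rowMultC-vanishes (-1≤i i∈) (below N≤m)
  beyond-x : ∀ {m} → ∣ x ∣ ≤ m → ℤ.suc y ℤ.< + m
  beyond-x ∣x∣≤m = ℤP.<-≤-trans (suc[i-c]<i x (ℕP.≤-trans (ℕP.*-monoʳ-≤ 2 (s≤s z≤n)) (ℕP.m≤m+n (2 * q) d)))
                                 (ℤP.≤-trans (i≤+∣i∣ x) (+≤+ ∣x∣≤m))
  beyond-y : ∀ {m} → suc (bound y) ≤ m → ℤ.suc y ℤ.< + m
  beyond-y 2+∣y∣≤m = ℤP.≤-<-trans (ℤP.suc-mono (i≤+∣i∣ y)) (+<+ 2+∣y∣≤m)
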